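{- Let $G=(K\cup I,E)$ be a split graph and $(V,\mathcal{F})$ the split graph vertex shelling antimatroid defined on $G$. If $I=\{i_1,\dots,i_{|I|}\}$, then $\mathcal{F}$ is the disjoint union $\mathcal{F}_{*}\uplus\mathcal{F}_{i_1}\uplus\cdots\uplus\mathcal{F}_{i_{|I|}}$.
   Context: All graphs are finite and simple. A split graph $G=(K\cup I,E)$ has vertex set $V=K\cup I$ partitioned into a clique $K$ and an independent set $I$ (either may be empty), the partition being given. For $S\subseteq V$, $N(S)$ is the set of vertices of $V\setminus S$ adjacent to some vertex of $S$. A vertex is simplicial if its neighbours induce a clique. The split graph vertex shelling antimatroid $(V,\mathcal{F})$ on $G$: $F\subseteq V$ is feasible iff there is an ordering $(f_1,\dots,f_{|F|})$ of $F$ such that each $f_j$ is simplicial in $G\setminus\{f_1,\dots,f_{j-1}\}$. A feasible set $F$ is $*$-feasible if $N(F)\subseteq K$; for $i\in I$, a feasible set $F$ is $i$-feasible if $i\in N(F)\cap I$. $\mathcal{F}_*$ denotes the family of $*$-feasible sets and $\mathcal{F}_i$ the family of $i$-feasible sets. -}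

module Defs where

open import Data.Nat using (ℕ)
open import Data.Fin using (Fin)
open import Data.Bool using (Bool; true; false)
open import Data.List using (List; []; _∷_)
open import Data.List.Membership.Propositional using () renaming (_∈_ to _∈L_; _∉_ to _∉L_)
open import Data.Fin.Subset using (Subset; _∈_; _∉_)
open import Data.Product using (Σ; _×_; ∃)
open import Data.Unit using (⊤)
open import Relation.Binary.PropositionalEquality using (_≡_; _≢_)
open import Relation.Nullary using (¬_)
open import Function.Bundles using (_⇔_)

-- A split graph on vertex set Fin n: a finite simple graph (symmetric,
-- irreflexive Bool-valued adjacency) with a given partition V = K ∪ I,
-- where inK v ≡ true means v ∈ K and inK v ≡ false means v ∈ I.
record SplitGraph (n : ℕ) : Set where
  field
    adj   : Fin n → Fin n → Bool
    inK   : Fin n → Bool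
    sym   : ∀ u v → adj u v ≡ adj v u
    irrefl : ∀ v → adj v v ≡ false
    K-clique : ∀ u v → inK u ≡ true → inK v ≡ true → u ≢ v → adj u v ≡ true
    I-indep  : ∀ u v → inK u ≡ false → inK v ≡ false → adj u v ≡ false

module _ {n : ℕ} (G : SplitGraph n) where
  open SplitGraph G

  -- v is simplicial in G ∖ R (R = list of removed vertices):
  -- v is still present, and any two distinct present neighbours of v are adjacent.
  Simplicial : List (Fin n) → Fin n → Set
  Simplicial R v = v ∉L R × (∀ u w → u ∉L R → w ∉L R → u ≢ w →
                    adj v u ≡ true → adj v w ≡ true → adj u w ≡ true)

  ShellFrom : List (Fin n) → List (Fin n) → Set
  ShellFrom R []       = ⊤
  ShellFrom R (x ∷ xs) = Simplicial R x × ShellFrom (x ∷ R) xs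

  Feasible : Subset n → Set
  Feasible F = Σ (List (Fin n)) λ xs → ShellFrom [] xs × (∀ v → (v ∈ F) ⇔ (v ∈L xs))

  InNbhd : Subset n → Fin n → Set
  InNbhd F v = v ∉ F × ∃ λ u → u ∈ F × adj u v ≡ true

  StarFeasible : Subset n → Set
  StarFeasible F = Feasible F × (∀ v → InNbhd F v → inK v ≡ true)

  IFeasible : Fin n → Subset n → Set
  IFeasible i F = Feasible F × inK i ≡ false × InNbhd F i

module Submission where

-- Call the I-boundary of a set R of removed vertices the set of
-- vertices of I outside R with a neighbour in R.  Along any shelling sequence
-- the removed set R satisfies the invariant
--   (a) every I-boundary vertex is adjacent to every clique vertex not in R, and
--   (b) the I-boundary has at most one element.
-- Removing a vertex of I adds nothing to the I-boundary (I is independent).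
-- Removing a simplicial clique vertex x: by (a) every I-boundary vertex of the
-- new removed set is a remaining neighbour of x, so two distinct ones would be
-- adjacent by simpliciality, contradicting the independence of I; and for a
-- boundary vertex i and a remaining clique vertex k, both neighbours of x,
-- simpliciality gives the edge ik.  Hence for every feasible F the set
-- N(F) ∩ I has at most one element, which is the disjointness of the F_i.
-- Covering is a finite case split on whether N(F) ∩ I is empty, and F_* is
-- disjoint from every F_i since N(F) ⊆ K excludes i ∈ N(F) ∩ I.

open import Defs
open import Data.Nat using (ℕ)
open import Data.Fin using (Fin)
open import Data.Fin.Subset using (Subset)
open import Data.Bool using (false)
open import Data.Product using (_×_; ∃)
open import Data.Sum using (_⊎_)
open import Relation.Binary.PropositionalEquality using (_≡_)
open import Relation.Nullary using (¬_)

open import Data.Bool using (true)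
open import Data.Bool.Properties using () renaming (_≟_ to _≟B_)
open import Data.Product using (_,_; proj₁; proj₂)
open import Data.Sum using (inj₁; inj₂)
open import Data.Empty using (⊥; ⊥-elim)
open import Data.List using (List; []; _∷_; reverse; reverseAcc)
open import Data.List.Membership.Propositional using () renaming (_∈_ to _∈L_; _∉_ to _∉L_)
open import Data.List.Relation.Unary.Any using (here; there)
open import Data.List.Relation.Unary.Any.Properties using (reverse⁺; reverse⁻)
open import Data.Fin.Subset using (_∈_)
open import Data.Fin.Subset.Properties using (_∈?_)
open import Data.Fin.Properties using (_≟_; any?)
open import Relation.Binary.PropositionalEquality using (_≢_; refl; trans)
open import Relation.Nullary using (Dec; yes; no)
open import Relation.Nullary.Decidable using (_×-dec_; ¬?)
open import Function.Bundles using (_⇔_; Equivalence)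

true-and-false : ∀ {b} → b ≡ true → b ≡ false → ⊥
true-and-false refl ()

module Shelling {n : ℕ} (G : SplitGraph n) where
  open SplitGraph G renaming (sym to adj-sym)

  I≢K : ∀ {i k} → inK i ≡ false → inK k ≡ true → i ≢ k
  I≢K i∈I k∈K refl = true-and-false k∈K i∈I

  OnIBoundary : List (Fin n) → Fin n → Set
  OnIBoundary R i = inK i ≡ false × i ∉L R × ∃ λ r → r ∈L R × adj r i ≡ true

  SeesRemainingClique : List (Fin n) → Set
  SeesRemainingClique R =
    ∀ i k → OnIBoundary R i → inK k ≡ true → k ∉L R → adj i k ≡ true

  AtMostOneIBoundary : List (Fin n) → Set
  AtMostOneIBoundary R = ∀ i j → OnIBoundary R i → OnIBoundary R j → i ≡ j

  Invariant : List (Fin n) → Set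
  Invariant R = SeesRemainingClique R × AtMostOneIBoundary R

  invariant-[] : Invariant []
  invariant-[] = (λ { _ _ (_ , _ , _ , () , _) }) , (λ { _ _ (_ , _ , _ , () , _) _ })

  boundary-∷ : ∀ {x R i} → OnIBoundary (x ∷ R) i →
               OnIBoundary R i ⊎ (adj x i ≡ true × i ∉L R)
  boundary-∷ (i∈I , i∉ , _ , here refl , xi) = inj₂ (xi , λ i∈R → i∉ (there i∈R))
  boundary-∷ (i∈I , i∉ , r , there r∈R , ri) =
    inj₁ (i∈I , (λ i∈R → i∉ (there i∈R)) , r , r∈R , ri)

  boundary-∷-I : ∀ {x R i} → inK x ≡ false → OnIBoundary (x ∷ R) i → OnIBoundary R i
  boundary-∷-I {x} {i = i} x∈I nb with boundary-∷ nb
  ... | inj₁ old       = old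
  ... | inj₂ (xi , _) = ⊥-elim (true-and-false xi (I-indep x i x∈I (proj₁ nb)))

  invariant-∷-I : ∀ {x R} → inK x ≡ false → Invariant R → Invariant (x ∷ R)
  invariant-∷-I x∈I (sees , one) =
      (λ i k nb k∈K k∉ → sees i k (boundary-∷-I x∈I nb) k∈K (λ k∈R → k∉ (there k∈R)))
    , (λ i j ni nj → one i j (boundary-∷-I x∈I ni) (boundary-∷-I x∈I nj))

  boundary-∷-K : ∀ {x R i} → SeesRemainingClique R → inK x ≡ true → x ∉L R →
                 OnIBoundary (x ∷ R) i → adj x i ≡ true × i ∉L R
  boundary-∷-K {x} {i = i} sees x∈K x∉R nb with boundary-∷ nb
  ... | inj₁ old = trans (adj-sym x i) (sees i x old x∈K x∉R) , proj₁ (proj₂ old)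
  ... | inj₂ new = new

  -- Removing a simplicial clique vertex preserves the invariant: (b) because two
  -- boundary vertices would be adjacent neighbours of x inside I, (a) by simpliciality.
  invariant-∷-K : ∀ {x R} → inK x ≡ true → Simplicial G R x → Invariant R →
                  Invariant (x ∷ R)
  invariant-∷-K {x} {R} x∈K (x∉R , simplicial) (sees , _) = sees′ , one′
    where
      near : ∀ {i} → OnIBoundary (x ∷ R) i → adj x i ≡ true × i ∉L R
      near = boundary-∷-K sees x∈K x∉R

      sees′ : SeesRemainingClique (x ∷ R)
      sees′ i k nb k∈K k∉ =
        simplicial i k (proj₂ (near nb)) (λ k∈R → k∉ (there k∈R)) (I≢K (proj₁ nb) k∈K)
          (proj₁ (near nb)) (K-clique x k x∈K k∈K (λ { refl → k∉ (here refl) }))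

      one′ : AtMostOneIBoundary (x ∷ R)
      one′ i j ni nj with i ≟ j
      ... | yes i≡j = i≡j
      ... | no i≢j  = ⊥-elim (true-and-false
              (simplicial i j (proj₂ (near ni)) (proj₂ (near nj)) i≢j (proj₁ (near ni)) (proj₁ (near nj)))
              (I-indep i j (proj₁ ni) (proj₁ nj)))

  invariant-∷ : ∀ {x R} → Simplicial G R x → Invariant R → Invariant (x ∷ R)
  invariant-∷ {x} simp inv with inK x in x-side
  ... | true  = invariant-∷-K x-side simp inv
  ... | false = invariant-∷-I x-side inv

  invariant-shell : ∀ xs R → Invariant R → ShellFrom G R xs → Invariant (reverseAcc R xs)
  invariant-shell []       R inv _           = inv
  invariant-shell (x ∷ xs) R inv (simp , sh) = invariant-shell xs (x ∷ R) (invariant-∷ simp inv) sh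

  nbhd⇒boundary : ∀ {F xs i} → (∀ v → (v ∈ F) ⇔ (v ∈L xs)) →
                  inK i ≡ false → InNbhd G F i → OnIBoundary (reverse xs) i
  nbhd⇒boundary F≃xs i∈I (i∉F , u , u∈F , ui) =
      i∈I
    , (λ i∈xs → i∉F (Equivalence.from (F≃xs _) (reverse⁻ i∈xs)))
    , u , reverse⁺ (Equivalence.to (F≃xs u) u∈F) , ui

  feasible-IBoundary-unique : ∀ {F i j} → Feasible G F →
    inK i ≡ false → InNbhd G F i → inK j ≡ false → InNbhd G F j → i ≡ j
  feasible-IBoundary-unique (xs , sh , F≃xs) i∈I i∈N j∈I j∈N =
    proj₂ (invariant-shell xs [] invariant-[] sh) _ _
      (nbhd⇒boundary F≃xs i∈I i∈N) (nbhd⇒boundary F≃xs j∈I j∈N)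

  IBoundary? : ∀ F i → Dec (inK i ≡ false × InNbhd G F i)
  IBoundary? F i =
    (inK i ≟B false) ×-dec (¬? (i ∈? F) ×-dec any? (λ u → (u ∈? F) ×-dec (adj u i ≟B true)))

  star-or-IFeasible : ∀ F → Feasible G F →
    StarFeasible G F ⊎ ∃ λ i → inK i ≡ false × IFeasible G i F
  star-or-IFeasible F feasible with any? (IBoundary? F)
  ... | yes (i , i∈I , i∈N) = inj₂ (i , i∈I , feasible , i∈I , i∈N)
  ... | no none             = inj₁ (feasible , N⊆K)
    where
      N⊆K : ∀ v → InNbhd G F v → inK v ≡ true
      N⊆K v v∈N with inK v in v-side
      ... | true  = refl
      ... | false = ⊥-elim (none (v , v-side , v∈N))

mainTheorem6 : {n : ℕ} (G : SplitGraph n) →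
    (∀ F → Feasible G F →
        StarFeasible G F ⊎ ∃ λ i → SplitGraph.inK G i ≡ false × IFeasible G i F)
    × (∀ F i → ¬ (StarFeasible G F × IFeasible G i F))
    × (∀ F i j → IFeasible G i F → IFeasible G j F → i ≡ j)
mainTheorem6 G = star-or-IFeasible , star-disjoint , IFeasible-unique
  where
    open Shelling G

    star-disjoint : ∀ F i → ¬ (StarFeasible G F × IFeasible G i F)
    star-disjoint F i ((_ , N⊆K) , (_ , i∈I , i∈N)) = true-and-false (N⊆K i i∈N) i∈I

    IFeasible-unique : ∀ F i j → IFeasible G i F → IFeasible G j F → i ≡ j
    IFeasible-unique F i j (feasible , i∈I , i∈N) (_ , j∈I , j∈N) =
      feasible-IBoundary-unique feasible i∈I i∈N j∈I j∈N
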